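{- The diamond product and the shuffle product on $\mathfrak D$ are commutative: $\mathfrak a\diamond\mathfrak b=\mathfrak b\diamond\mathfrak a$ and $\mathfrak a\sqcup\!\sqcup\mathfrak b=\mathfrak b\sqcup\!\sqcup\mathfrak a$ for all $\mathfrak a,\mathfrak b\in\mathfrak D$.
   Context: Let $q$ be a prime power, $\mathbb F_q$ the field with $q$ elements, $\mathbb N=\{1,2,\dots\}$. Let $\Gamma=\{x_{n,\varepsilon}: n\in\mathbb N,\ \varepsilon\in\mathbb F_q^*\}$ be an alphabet. A word is a finite string of letters; the empty word is $1$. Let $\mathfrak D$ be the $\mathbb F_q$-vector space with basis the set of words, with concatenation extended bilinearly. A nonempty word is written $\mathfrak a=x_{a,\alpha}\mathfrak a_-$ with $x_{a,\alpha}$ its first letter. For positive integers $r,s,j$ put $\Delta^j_{r,s}=(-1)^{r-1}\binom{j-1}{r-1}+(-1)^{s-1}\binom{j-1}{s-1}\in\mathbb F_q$ if $(q-1)\mid j$ and $0$ otherwise. The diamond product $\diamond$ and shuffle product $\sqcup\!\sqcup$ are the bilinear maps $\mathfrak D\times\mathfrak D\to\mathfrak D$ defined recursively by $1\diamond\mathfrak a=\mathfrak a\diamond 1=\mathfrak a$, $1\sqcup\!\sqcup\mathfrak a=\mathfrak a\sqcup\!\sqcup 1=\mathfrak a$, and for nonempty $\mathfrak a=x_{a,\alpha}\mathfrak a_-$, $\mathfrak b=x_{b,\beta}\mathfrak b_-$: $\mathfrak a\diamond\mathfrak b=x_{a+b,\alpha\beta}(\mathfrak a_-\sqcup\!\sqcup\mathfrak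 b_-)+\sum_{i+j=a+b}\Delta^j_{a,b}\,x_{i,\alpha\beta}\big(x_{j,1}\sqcup\!\sqcup(\mathfrak a_-\sqcup\!\sqcup\mathfrak b_-)\big)$ (over positive $i,j$), and $\mathfrak a\sqcup\!\sqcup\mathfrak b=x_{a,\alpha}(\mathfrak a_-\sqcup\!\sqcup\mathfrak b)+x_{b,\beta}(\mathfrak a\sqcup\!\sqcup\mathfrak b_-)+\mathfrak a\diamond\mathfrak b$. -}

module Defs where

open import Level using (0ℓ)
open import Data.Nat as Nat using (ℕ; zero; suc; _∸_; _^_)
open import Data.Nat.Divisibility using (_∣_; _∣?_)
open import Data.Nat.Primality using (Prime)
open import Data.Nat.Combinatorics using (_C_)
open import Data.Bool using (Bool; true; false; _∧_; if_then_else_)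
open import Data.Fin using (Fin)
import Data.Fin.Properties as FinP
open import Data.List using (List; []; _∷_; _++_; map; concatMap; upTo; length; foldr)
open import Data.Product using (_×_; _,_; Σ; ∃; ∃-syntax)
open import Relation.Nullary using (¬_; Dec; yes; no)
open import Relation.Nullary.Decidable using (⌊_⌋; map′)
open import Relation.Binary.PropositionalEquality using (_≡_; _≢_; refl; cong; sym; trans)
open import Relation.Binary.Definitions using (DecidableEquality)
open import Algebra.Structures using (IsCommutativeRing)
open import Function.Bundles using (_↔_; Inverse)

IsPrimePower : ℕ → Set
IsPrimePower q = ∃[ p ] ∃[ k ] (Prime p × q ≡ p ^ suc k)

record FiniteField (q : ℕ) : Set₁ where
  infixl 7 _*_
  infixl 6 _+_
  field
    Carrier : Set
    _+_ _*_ : Carrier → Carrier → Carrier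
    -_      : Carrier → Carrier
    0# 1#   : Carrier
    _⁻¹     : Carrier → Carrier
    isCommutativeRing : IsCommutativeRing _≡_ _+_ _*_ -_ 0# 1#
    0≢1     : 0# ≢ 1#
    ⁻¹-inverse : ∀ x → x ≢ 0# → x * (x ⁻¹) ≡ 1#
    card    : Carrier ↔ Fin q

  open IsCommutativeRing isCommutativeRing public
    using (*-assoc; *-comm; zeroˡ; *-identityˡ)

  _≟_ : DecidableEquality Carrier
  x ≟ y = map′ inj (cong (Inverse.to card))
               (Inverse.to card x FinP.≟ Inverse.to card y)
    where
    inj : Inverse.to card x ≡ Inverse.to card y → x ≡ y
    inj e = trans (sym (Inverse.strictlyInverseʳ card x))
                  (trans (cong (Inverse.from card) e) (Inverse.strictlyInverseʳ card y))

  *-nonzero : ∀ {x y} → x ≢ 0# → y ≢ 0# → x * y ≢ 0#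
  *-nonzero {x} {y} x≢0 y≢0 xy≡0 = 0≢1 (sym 1≡0)
    where
    open Relation.Binary.PropositionalEquality.≡-Reasoning
    1≡0 : 1# ≡ 0#
    1≡0 = begin
      1#                                   ≡⟨ sym (⁻¹-inverse y y≢0) ⟩
      y * (y ⁻¹)                           ≡⟨ cong (_* (y ⁻¹)) (sym (*-identityˡ y)) ⟩
      (1# * y) * (y ⁻¹)                    ≡⟨ cong (λ z → (z * y) * (y ⁻¹)) (sym (⁻¹-inverse x x≢0)) ⟩
      ((x * (x ⁻¹)) * y) * (y ⁻¹)          ≡⟨ cong (_* (y ⁻¹)) (*-assoc x (x ⁻¹) y) ⟩
      (x * ((x ⁻¹) * y)) * (y ⁻¹)          ≡⟨ cong (λ z → (x * z) * (y ⁻¹)) (*-comm (x ⁻¹) y) ⟩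
      (x * (y * (x ⁻¹))) * (y ⁻¹)          ≡⟨ cong (_* (y ⁻¹)) (sym (*-assoc x y (x ⁻¹))) ⟩
      ((x * y) * (x ⁻¹)) * (y ⁻¹)          ≡⟨ cong (λ z → (z * (x ⁻¹)) * (y ⁻¹)) xy≡0 ⟩
      (0# * (x ⁻¹)) * (y ⁻¹)               ≡⟨ cong (_* (y ⁻¹)) (zeroˡ (x ⁻¹)) ⟩
      0# * (y ⁻¹)                          ≡⟨ zeroˡ (y ⁻¹) ⟩
      0# ∎

module Words {q : ℕ} (F : FiniteField q) where
  open FiniteField F

  -- the letter x_{n,ε} with n = suc pidx ∈ ℕ = {1,2,…} and ε ∈ F_q^*
  record Letter : Set where
    constructor letter
    field
      pidx : ℕ
      ε    : Carrier
      ε≢0  : ε ≢ 0#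

  index : Letter → ℕ
  index x = suc (Letter.pidx x)

  Word : Set
  Word = List Letter

  _==ᴸ_ : Letter → Letter → Bool
  letter m α _ ==ᴸ letter n β _ = ⌊ m Nat.≟ n ⌋ ∧ ⌊ α ≟ β ⌋

  _==ᵂ_ : Word → Word → Bool
  []      ==ᵂ []      = true
  (x ∷ a) ==ᵂ (y ∷ b) = (x ==ᴸ y) ∧ (a ==ᵂ b)
  _       ==ᵂ _       = false

  -- elements of 𝔇: finite formal F_q-linear combinations of words
  𝔇 : Set
  𝔇 = List (Carrier × Word)

  coeff : 𝔇 → Word → Carrier
  coeff []            w = 0#
  coeff ((c , v) ∷ d) w = (if v ==ᵂ w then c else 0#) + coeff d w

  infix 4 _≈_
  _≈_ : 𝔇 → 𝔇 → Set
  d ≈ e = ∀ w → coeff d w ≡ coeff e w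

  word : Word → 𝔇
  word w = (1# , w) ∷ []

  scale : Carrier → 𝔇 → 𝔇
  scale c = map (λ { (d , w) → (c * d , w) })

  prepend : Letter → 𝔇 → 𝔇
  prepend x = map (λ { (c , w) → (c , x ∷ w) })

  embℕ : ℕ → Carrier
  embℕ zero    = 0#
  embℕ (suc n) = 1# + embℕ n

  sgn : ℕ → Carrier
  sgn zero    = 1#
  sgn (suc k) = - (sgn k)

  -- Δ^j_{r,s} with r = suc r', s = suc s', j = suc j'
  Δ : ℕ → ℕ → ℕ → Carrier
  Δ r' s' j' with (q ∸ 1) ∣? suc j'
  ... | yes _ = sgn r' * embℕ (j' C r') + sgn s' * embℕ (j' C s')
  ... | no  _ = 0#

  1≢0 : 1# ≢ 0#
  1≢0 e = 0≢1 (sym e)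

  -- the letter x_{a+b, αβ} for x = x_{a,α}, y = x_{b,β}
  fuse : Letter → Letter → Letter
  fuse (letter a' α α≢0) (letter b' β β≢0) =
    letter (suc (a' Nat.+ b')) (α * β) (*-nonzero α≢0 β≢0)

  -- Word-level products with a fuel argument guaranteeing termination.
  -- With fuel ≥ length a + length b the fuel is never exhausted
  --, so the fuel does not affect the value.
  mutual
    sh : ℕ → Word → Word → 𝔇
    sh n       []      b       = word b
    sh n       (x ∷ a) []      = word (x ∷ a)
    sh zero    (x ∷ a) (y ∷ b) = []
    sh (suc n) (x ∷ a) (y ∷ b) =
      prepend x (sh n a (y ∷ b)) ++ prepend y (sh n (x ∷ a) b) ++ dia n (x ∷ a) (y ∷ b)

    shLetter : ℕ → Letter → 𝔇 → 𝔇
    shLetter n z []            = []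
    shLetter n z ((c , w) ∷ d) = scale c (sh n (z ∷ []) w) ++ shLetter n z d

    dia : ℕ → Word → Word → 𝔇
    dia n []      b       = word b
    dia n (x ∷ a) []      = word (x ∷ a)
    dia n (x ∷ a) (y ∷ b) =
      prepend (fuse x y) (sh n a b) ++
      concatMap
        (λ i' → scale (Δ (Letter.pidx x) (Letter.pidx y) (N ∸ i'))
                  (prepend (letter i' (Letter.ε x * Letter.ε y)
                                      (*-nonzero (Letter.ε≢0 x) (Letter.ε≢0 y)))
                     (shLetter n (letter (N ∸ i') 1# 1≢0) (sh n a b))))
        (upTo (suc N))
      where
      -- a + b = suc (suc N); the pairs (i , j) = (suc i' , suc (N ∸ i')),
      -- i' = 0 … N, are exactly the positive i , j with i + j = a + b
      N : ℕ
      N = Letter.pidx x Nat.+ Letter.pidx y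

  _⋄ᵂ_ : Word → Word → 𝔇
  a ⋄ᵂ b = dia (length a Nat.+ length b) a b

  _⧢ᵂ_ : Word → Word → 𝔇
  a ⧢ᵂ b = sh (length a Nat.+ length b) a b

  bilin : (Word → Word → 𝔇) → 𝔇 → 𝔇 → 𝔇
  bilin f d e = concatMap (λ { (c , v) → concatMap (λ { (c' , w) → scale (c * c') (f v w) }) e }) d

  infixl 7 _⋄_ _⧢_
  _⋄_ : 𝔇 → 𝔇 → 𝔇
  _⋄_ = bilin _⋄ᵂ_

  _⧢_ : 𝔇 → 𝔇 → 𝔇
  _⧢_ = bilin _⧢ᵂ_

{-# OPTIONS --safe #-}
-- Both products are computed by recursions that produce lists of terms, and exchanging the
-- arguments only permutes these lists.  For the shuffle of x𝔞 and y𝔟 the two "first letter"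
-- summands trade places, and the diamond summand is symmetric because fusing letters is
-- commutative ((a + b , αβ) = (b + a , βα)) and Δ^j_{r,s} = Δ^j_{s,r}.  Permuting terms does not
-- change any coefficient, and the bilinear extension of a commutative product is commutative.
module Submission where

open import Defs
open import Level using (Level; 0ℓ)
open import Data.Bool using (_∧_; if_then_else_)
open import Data.List using (List; []; _∷_; _++_; map; concatMap; foldr; upTo; length)
import Data.List.Properties as List
open import Data.List.Relation.Binary.Pointwise using ([]; _∷_)
import Data.List.Relation.Binary.Equality.Setoid as ListEquality
import Data.List.Relation.Binary.Permutation.Homogeneous as Homogeneous
import Data.List.Relation.Binary.Permutation.Setoid as Permutation
import Data.List.Relation.Binary.Permutation.Setoid.Properties as Permutationₚ
open import Data.Nat as Nat using (ℕ; zero; suc; _∸_)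
import Data.Nat.Properties as ℕ
open import Data.Nat.Divisibility using (_∣?_)
open import Data.Product using (_×_; _,_)
open import Data.Product.Relation.Binary.Pointwise.NonDependent using (_×ₛ_)
open import Algebra.Structures using (IsCommutativeRing)
open import Relation.Binary.Bundles using (Setoid)
open import Relation.Binary.PropositionalEquality as ≡
  using (_≡_; _≢_; refl; cong; cong₂; sym; trans; module ≡-Reasoning)
open import Relation.Nullary using (yes; no)

private
  variable
    ℓᵃ ℓᶜ : Level
    A : Set ℓᵃ
    C : Set ℓᶜ

module _ {b ℓ} (S : Setoid b ℓ) where
  open Setoid S using () renaming (Carrier to B)
  open Permutation S using (_↭_; ↭-refl; ↭-sym; ↭-reflexive; module PermutationReasoning)
  open Permutationₚ S using (++⁺; ++⁺ˡ; shifts)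

  concatMap-cong : {f g : A → List B} → (∀ x → f x ↭ g x) →
    ∀ xs → concatMap f xs ↭ concatMap g xs
  concatMap-cong f↭g []       = ↭-refl
  concatMap-cong f↭g (x ∷ xs) = ++⁺ (f↭g x) (concatMap-cong f↭g xs)

  concatMap-++ : ∀ (f g : A → List B) xs →
    concatMap (λ x → f x ++ g x) xs ↭ concatMap f xs ++ concatMap g xs
  concatMap-++ f g []       = ↭-refl
  concatMap-++ f g (x ∷ xs) = begin
    (f x ++ g x) ++ concatMap (λ x → f x ++ g x) xs  ≡⟨ List.++-assoc (f x) (g x) _ ⟩
    f x ++ g x ++ concatMap (λ x → f x ++ g x) xs
      ↭⟨ ++⁺ˡ (f x) (++⁺ˡ (g x) (concatMap-++ f g xs)) ⟩
    f x ++ g x ++ concatMap f xs ++ concatMap g xs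
      ↭⟨ ++⁺ˡ (f x) (shifts (g x) (concatMap f xs)) ⟩
    f x ++ concatMap f xs ++ g x ++ concatMap g xs   ≡⟨ List.++-assoc (f x) (concatMap f xs) _ ⟨
    (f x ++ concatMap f xs) ++ g x ++ concatMap g xs ∎
    where open PermutationReasoning

  concatMap-const-[] : (ys : List C) → concatMap {B = B} (λ _ → []) ys ≡ []
  concatMap-const-[] []       = refl
  concatMap-const-[] (y ∷ ys) = concatMap-const-[] ys

  concatMap-comm : ∀ (G : A → C → List B) xs ys →
    concatMap (λ x → concatMap (G x) ys) xs ↭ concatMap (λ y → concatMap (λ x → G x y) xs) ys
  concatMap-comm G []       ys = ↭-sym (↭-reflexive (concatMap-const-[] ys))
  concatMap-comm G (x ∷ xs) ys = begin
    concatMap (G x) ys ++ concatMap (λ x → concatMap (G x) ys) xs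
      ↭⟨ ++⁺ˡ (concatMap (G x) ys) (concatMap-comm G xs ys) ⟩
    concatMap (G x) ys ++ concatMap (λ y → concatMap (λ x → G x y) xs) ys
      ↭⟨ concatMap-++ (G x) (λ y → concatMap (λ x → G x y) xs) ys ⟨
    concatMap (λ y → G x y ++ concatMap (λ x → G x y) xs) ys ∎
    where open PermutationReasoning

module _ {a b ℓ₁ ℓ₂} (S : Setoid a ℓ₁) (T : Setoid b ℓ₂) where
  open Setoid S using (_≈_)
  open ListEquality S using (_≋_)
  open Permutation S using () renaming (_↭_ to _↭ₛ_)
  open Permutation T using (_↭_; ↭-refl; ↭-trans)
  open Permutationₚ T using (++⁺; shifts)

  concatMap⁺ : {f : Setoid.Carrier S → List (Setoid.Carrier T)} →
    (∀ {x y} → x ≈ y → f x ↭ f y) →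
    ∀ {xs ys} → xs ↭ₛ ys → concatMap f xs ↭ concatMap f ys
  concatMap⁺ {f} f⁺ (Homogeneous.refl xs≋ys) = concatMap-≋ xs≋ys
    where
    concatMap-≋ : ∀ {xs ys} → xs ≋ ys → concatMap f xs ↭ concatMap f ys
    concatMap-≋ []              = ↭-refl
    concatMap-≋ (x≈y ∷ xs≋ys) = ++⁺ (f⁺ x≈y) (concatMap-≋ xs≋ys)
  concatMap⁺ f⁺ (Homogeneous.prep x≈y xs↭ys) = ++⁺ (f⁺ x≈y) (concatMap⁺ f⁺ xs↭ys)
  concatMap⁺ {f} f⁺ (Homogeneous.swap {x = x} {y = y} x≈x′ y≈y′ xs↭ys) =
    ↭-trans (shifts (f x) (f y))
            (++⁺ (f⁺ y≈y′) (++⁺ (f⁺ x≈x′) (concatMap⁺ f⁺ xs↭ys)))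
  concatMap⁺ f⁺ (Homogeneous.trans xs↭ys ys↭zs) =
    ↭-trans (concatMap⁺ f⁺ xs↭ys) (concatMap⁺ f⁺ ys↭zs)

module WordProducts {q : ℕ} (F : FiniteField q) where
  open FiniteField F
  open Words F
  open IsCommutativeRing isCommutativeRing using (+-comm; +-isCommutativeMonoid)

  key : Letter → ℕ × Carrier
  key x = Letter.pidx x , Letter.ε x

  -- Proofs of ε ≢ 0# need not be equal, so letters are only compared through their key.
  data _≈ᴸ_ : Letter → Letter → Set where
    same-key : ∀ {x y} → key x ≡ key y → x ≈ᴸ y

  Letter-setoid : Setoid 0ℓ 0ℓ
  Letter-setoid = record
    { _≈_           = _≈ᴸ_
    ; isEquivalence = record
      { refl  = same-key refl
      ; sym   = λ { (same-key e) → same-key (sym e) }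
      ; trans = λ { (same-key e) (same-key e′) → same-key (trans e e′) }
      }
    }

  open ListEquality Letter-setoid using (_≋_; ≋-setoid; ≋-refl)

  Term-setoid : Setoid 0ℓ 0ℓ
  Term-setoid = ≡.setoid Carrier ×ₛ ≋-setoid

  open Setoid Term-setoid using () renaming (_≈_ to _≈ᵀ_)
  open ListEquality Term-setoid using () renaming (_≋_ to _≋ᵀ_)
  open Permutation Term-setoid
    using (_↭_; ↭-refl; ↭-trans; ↭-reflexive; ↭-reflexive-≋; module PermutationReasoning)
  open Permutationₚ Term-setoid using (++⁺; shifts; map⁺)
  open Permutationₚ (≡.setoid Carrier) using (foldr-commMonoid)

  termCoeff : Word → Carrier × Word → Carrier
  termCoeff w (c , v) = if v ==ᵂ w then c else 0#

  coeff≡foldr : ∀ d w → coeff d w ≡ foldr _+_ 0# (map (termCoeff w) d)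
  coeff≡foldr []      w = refl
  coeff≡foldr (t ∷ d) w = cong (termCoeff w t +_) (coeff≡foldr d w)

  ==ᴸ-respˡ : ∀ {x x′} y → x ≈ᴸ x′ → (x ==ᴸ y) ≡ (x′ ==ᴸ y)
  ==ᴸ-respˡ y (same-key refl) = refl

  ==ᵂ-respˡ : ∀ w {v v′} → v ≋ v′ → (v ==ᵂ w) ≡ (v′ ==ᵂ w)
  ==ᵂ-respˡ w       []      = refl
  ==ᵂ-respˡ []      (_ ∷ _) = refl
  ==ᵂ-respˡ (y ∷ w) (x≈x′ ∷ v≋v′) =
    cong₂ _∧_ (==ᴸ-respˡ y x≈x′) (==ᵂ-respˡ w v≋v′)

  termCoeff-resp : ∀ w {s t} → s ≈ᵀ t → termCoeff w s ≡ termCoeff w t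
  termCoeff-resp w {c , _} (refl , v≋v′) = cong (if_then c else 0#) (==ᵂ-respˡ w v≋v′)

  ↭⇒≈ : ∀ {d e} → d ↭ e → d ≈ e
  ↭⇒≈ {d} {e} d↭e w = begin
    coeff d w                          ≡⟨ coeff≡foldr d w ⟩
    foldr _+_ 0# (map (termCoeff w) d) ≡⟨ foldr-commMonoid +-isCommutativeMonoid
                                            (map⁺ (≡.setoid Carrier) (termCoeff-resp w) d↭e) ⟩
    foldr _+_ 0# (map (termCoeff w) e) ≡⟨ coeff≡foldr e w ⟨
    coeff e w                          ∎
    where open ≡-Reasoning

  word-resp : ∀ {v v′} → v ≋ v′ → word v ↭ word v′
  word-resp v≋v′ = ↭-reflexive-≋ ((refl , v≋v′) ∷ [])

  scale-resp : ∀ {c c′ d e} → c ≡ c′ → d ↭ e → scale c d ↭ scale c′ e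
  scale-resp refl = map⁺ Term-setoid (λ (c≡c′ , w≋w′) → cong (_ *_) c≡c′ , w≋w′)

  prepend-≋ : ∀ {x x′} → x ≈ᴸ x′ → ∀ d → prepend x d ≋ᵀ prepend x′ d
  prepend-≋ x≈x′ []      = []
  prepend-≋ x≈x′ (_ ∷ d) = (refl , x≈x′ ∷ ≋-refl) ∷ prepend-≋ x≈x′ d

  prepend-resp : ∀ {x x′ d e} → x ≈ᴸ x′ → d ↭ e → prepend x d ↭ prepend x′ e
  prepend-resp {e = e} x≈x′ d↭e = ↭-trans
    (map⁺ Term-setoid (λ (c≡c′ , w≋w′) → c≡c′ , (same-key refl ∷ w≋w′)) d↭e)
    (↭-reflexive-≋ (prepend-≋ x≈x′ e))

  fuse-comm : ∀ x y → fuse x y ≈ᴸ fuse y x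
  fuse-comm x y = same-key (cong₂ (λ m γ → suc m , γ)
    (ℕ.+-comm (Letter.pidx x) (Letter.pidx y)) (*-comm (Letter.ε x) (Letter.ε y)))

  Δ-comm : ∀ r s j → Δ r s j ≡ Δ s r j
  Δ-comm r s j with (q ∸ 1) ∣? suc j
  ... | yes _ = +-comm _ _
  ... | no  _ = refl

  shTerm : ℕ → Letter → Carrier × Word → 𝔇
  shTerm n z (c , w) = scale c (sh n (z ∷ []) w)

  shLetter≡concatMap : ∀ n z d → shLetter n z d ≡ concatMap (shTerm n z) d
  shLetter≡concatMap n z []      = refl
  shLetter≡concatMap n z (t ∷ d) = cong (shTerm n z t ++_) (shLetter≡concatMap n z d)

  -- The sum over i + j = a + b in the diamond product of x_{r+1,α}𝔞 and x_{s+1,β}𝔟, with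
  -- γ = αβ and d = 𝔞 ⧢ 𝔟; `dia` unfolds to `prepend (fuse x y) (sh n a b) ++ Δ-terms …`.
  Δ-term : ℕ → (r s : ℕ) (γ : Carrier) → γ ≢ 0# → 𝔇 → ℕ → 𝔇
  Δ-term n r s γ γ≢0 d i =
    scale (Δ r s (r Nat.+ s ∸ i))
      (prepend (letter i γ γ≢0) (shLetter n (letter (r Nat.+ s ∸ i) 1# 1≢0) d))

  Δ-terms : ℕ → (r s : ℕ) (γ : Carrier) → γ ≢ 0# → 𝔇 → 𝔇
  Δ-terms n r s γ γ≢0 d = concatMap (Δ-term n r s γ γ≢0 d) (upTo (suc (r Nat.+ s)))

  -- Commutativity is proved up to ≋ so that congruence (sh-resp) follows by applying it twice.
  mutual
    sh-comm : ∀ n {a a′ b b′} → a ≋ a′ → b ≋ b′ → sh n a b ↭ sh n b′ a′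
    sh-comm n       []          []          = ↭-refl
    sh-comm n       []          (y≈ ∷ b≋)   = word-resp (y≈ ∷ b≋)
    sh-comm n       (x≈ ∷ a≋)   []          = word-resp (x≈ ∷ a≋)
    sh-comm zero    (_ ∷ _)     (_ ∷ _)     = ↭-refl
    sh-comm (suc n) {x ∷ a} {x′ ∷ a′} {y ∷ b} {y′ ∷ b′} (x≈ ∷ a≋) (y≈ ∷ b≋) =
      ↭-trans
        (++⁺ (prepend-resp x≈ (sh-comm n a≋ (y≈ ∷ b≋)))
          (++⁺ (prepend-resp y≈ (sh-comm n (x≈ ∷ a≋) b≋))
               (dia-comm n (x≈ ∷ a≋) (y≈ ∷ b≋))))
        (shifts (prepend x′ (sh n (y′ ∷ b′) a′)) (prepend y′ (sh n b′ (x′ ∷ a′))))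

    dia-comm : ∀ n {a a′ b b′} → a ≋ a′ → b ≋ b′ → dia n a b ↭ dia n b′ a′
    dia-comm n []        []        = ↭-refl
    dia-comm n []        (y≈ ∷ b≋) = word-resp (y≈ ∷ b≋)
    dia-comm n (x≈ ∷ a≋) []        = word-resp (x≈ ∷ a≋)
    dia-comm n {x ∷ _} {_} {y ∷ _} (same-key refl ∷ a≋) (same-key refl ∷ b≋) =
      ++⁺ (prepend-resp (fuse-comm x y) (sh-comm n a≋ b≋))
          (Δ-terms-comm n (Letter.pidx x) (Letter.pidx y) (*-comm (Letter.ε x) (Letter.ε y))
            (sh-comm n a≋ b≋))

    sh-resp : ∀ n {a a′ b b′} → a ≋ a′ → b ≋ b′ → sh n a b ↭ sh n a′ b′
    sh-resp n {a′ = a′} {b′ = b′} a≋ b≋ =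
      ↭-trans (sh-comm n a≋ b≋) (sh-comm n (≋-refl {b′}) (≋-refl {a′}))

    shLetter-resp : ∀ n {z z′ d e} → z ≈ᴸ z′ → d ↭ e →
      shLetter n z d ↭ shLetter n z′ e
    shLetter-resp n {z} {z′} {d} {e} z≈z′ d↭e = begin
      shLetter n z d
        ≡⟨ shLetter≡concatMap n z d ⟩
      concatMap (shTerm n z) d
        ↭⟨ concatMap⁺ Term-setoid Term-setoid (λ (c≡c′ , w≋w′) →
             scale-resp c≡c′ (sh-resp n (≋-refl {z ∷ []}) w≋w′)) d↭e ⟩
      concatMap (shTerm n z) e
        ↭⟨ concatMap-cong Term-setoid (λ (_ , w) →
             scale-resp refl (sh-resp n (z≈z′ ∷ []) (≋-refl {w}))) e ⟩
      concatMap (shTerm n z′) e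
        ≡⟨ shLetter≡concatMap n z′ e ⟨
      shLetter n z′ e ∎
      where open PermutationReasoning

    Δ-terms-comm : ∀ n r s {γ γ′ γ≢0 γ′≢0 d e} → γ ≡ γ′ → d ↭ e →
      Δ-terms n r s γ γ≢0 d ↭ Δ-terms n s r γ′ γ′≢0 e
    Δ-terms-comm n r s {γ} {γ′} {γ≢0} {γ′≢0} {d} {e} γ≡γ′ d↭e = ↭-trans
      (concatMap-cong Term-setoid Δ-term-comm (upTo (suc (r Nat.+ s))))
      (↭-reflexive
        (cong (λ N → concatMap (Δ-term n s r γ′ γ′≢0 e) (upTo (suc N))) (ℕ.+-comm r s)))
      where
      Δ-term-comm : ∀ i → Δ-term n r s γ γ≢0 d i ↭ Δ-term n s r γ′ γ′≢0 e i
      Δ-term-comm i = scale-resp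
        (trans (Δ-comm r s _) (cong (λ N → Δ s r (N ∸ i)) (ℕ.+-comm r s)))
        (prepend-resp (same-key (cong (i ,_) γ≡γ′))
          (shLetter-resp n (same-key (cong (λ N → N ∸ i , 1#) (ℕ.+-comm r s))) d↭e))

  bilin-comm : ∀ (f : Word → Word → 𝔇) → (∀ v w → f v w ↭ f w v) →
    ∀ d e → bilin f d e ↭ bilin f e d
  bilin-comm f f-comm d e = ↭-trans
    (concatMap-comm Term-setoid (λ (c , v) (c′ , w) → scale (c * c′) (f v w)) d e)
    (concatMap-cong Term-setoid (λ (c′ , w) → concatMap-cong Term-setoid
       (λ (c , v) → scale-resp (*-comm c c′) (f-comm v w)) d) e)

  ⋄ᵂ-comm : ∀ v w → v ⋄ᵂ w ↭ w ⋄ᵂ v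
  ⋄ᵂ-comm v w = ↭-trans (dia-comm _ (≋-refl {v}) (≋-refl {w}))
    (↭-reflexive (cong (λ n → dia n w v) (ℕ.+-comm (length v) (length w))))

  ⧢ᵂ-comm : ∀ v w → v ⧢ᵂ w ↭ w ⧢ᵂ v
  ⧢ᵂ-comm v w = ↭-trans (sh-comm _ (≋-refl {v}) (≋-refl {w}))
    (↭-reflexive (cong (λ n → sh n w v) (ℕ.+-comm (length v) (length w))))

proposition5p1 : (q : ℕ) → IsPrimePower q → (F : FiniteField q) →
    let open Words F in
    (𝔞 𝔟 : 𝔇) → (𝔞 ⋄ 𝔟 ≈ 𝔟 ⋄ 𝔞) × (𝔞 ⧢ 𝔟 ≈ 𝔟 ⧢ 𝔞)
proposition5p1 q _ F 𝔞 𝔟 =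
  ↭⇒≈ (bilin-comm _⋄ᵂ_ ⋄ᵂ-comm 𝔞 𝔟) , ↭⇒≈ (bilin-comm _⧢ᵂ_ ⧢ᵂ-comm 𝔞 𝔟)
  where
  open Words F
  open WordProducts F
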